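{- Let $p$ be an $\mathrm{evenlevel}(v)$ path or an $\mathrm{oddlevel}(v)$ path and let $u$ lie on $p$. If $u$ is not BFS-honest with respect to $p$, then $\mathrm{t}(u)<\mathrm{t}(v)$.
   Context: $G=(V,E)$ is a finite undirected graph and $M$ a matching; edges in $M$ are matched, others unmatched; a vertex is unmatched if no matched edge is incident to it. An alternating path is a simple path whose edges alternate between matched and unmatched. $\mathrm{evenlevel}(v)$ ($\mathrm{oddlevel}(v)$) is the length of a minimum even (odd) length alternating path from some unmatched vertex to $v$ ($\infty$ if none); such a path is called an $\mathrm{evenlevel}(v)$ ($\mathrm{oddlevel}(v)$) path. Tenacity $\mathrm{t}(v)=\mathrm{evenlevel}(v)+\mathrm{oddlevel}(v)$. For $u$ on a path $p$ starting at unmatched vertex $f$, $u$ is even (odd) w.r.t. $p$ if the length of the subpath $p[f\text{ to }u]$ is even (odd), and $u$ is BFS-honest w.r.t. $p$ if that length equals $\mathrm{evenlevel}(u)$ when $u$ is even w.r.t. $p$, and $\mathrm{oddlevel}(u)$ when $u$ is odd w.r.t. $p$. -}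

module Defs where

open import Data.Nat using (ℕ; zero; suc; _+_; _≤_; _<_; _%_)
open import Data.Fin using (Fin)
open import Data.List using (List; []; _∷_)
open import Data.List.Relation.Unary.Unique.Propositional using (Unique)
open import Data.Bool using (Bool; true; false; not)
open import Data.Product using (Σ; ∃; _×_; _,_)
open import Data.Empty using (⊥)
open import Data.Unit using (⊤)
open import Relation.Nullary using (¬_)
open import Relation.Binary.PropositionalEquality using (_≡_)

data ℕ∞ : Set where
  fin : ℕ → ℕ∞
  ∞   : ℕ∞

_+∞_ : ℕ∞ → ℕ∞ → ℕ∞
fin a +∞ fin b = fin (a + b)
fin _ +∞ ∞     = ∞
∞     +∞ _     = ∞

_<∞_ : ℕ∞ → ℕ∞ → Set
fin a <∞ fin b = a < b
fin _ <∞ ∞     = ⊤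
∞     <∞ _     = ⊥

Even : ℕ → Set
Even k = k % 2 ≡ 0

Odd : ℕ → Set
Odd k = k % 2 ≡ 1

record Graph : Set₁ where
  field
    n      : ℕ
    Adj    : Fin n → Fin n → Set
    sym    : ∀ {x y} → Adj x y → Adj y x
    irrefl : ∀ {x} → ¬ Adj x x

record IsMatching (G : Graph) (M : Fin (Graph.n G) → Fin (Graph.n G) → Set) : Set where
  open Graph G
  field
    sub  : ∀ {x y} → M x y → Adj x y
    msym : ∀ {x y} → M x y → M y x
    func : ∀ {x y z} → M x y → M x z → y ≡ z

module _ (G : Graph) (M : Fin (Graph.n G) → Fin (Graph.n G) → Set) where
  open Graph G

  V : Set
  V = Fin n

  Unmatched : V → Set
  Unmatched x = ∀ y → ¬ M x y

  EdgeKind : Bool → V → V → Set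
  EdgeKind true  x y = M x y
  EdgeKind false x y = ¬ M x y

  data AltWalk : Bool → V → V → ℕ → Set where
    here : ∀ {b x} → AltWalk b x x 0
    step : ∀ {b x y z k} → Adj x y → EdgeKind b x y →
           AltWalk (not b) y z k → AltWalk b x z (suc k)

  verts : ∀ {b x z k} → AltWalk b x z k → List V
  verts {x = x} here = x ∷ []
  verts {x = x} (step _ _ w) = x ∷ verts w

  -- An alternating (simple) path from the unmatched vertex f to v of length k.
  -- (From an unmatched vertex, the first edge is necessarily unmatched.)
  record AltPath (f v : V) (k : ℕ) : Set where
    constructor altPath
    field
      unmatchedStart : Unmatched f
      walk           : AltWalk false f v k
      simple         : Unique (verts walk)

  data At : ∀ {b x z k} → AltWalk b x z k → V → ℕ → Set where
    at-start : ∀ {b x z k} {w : AltWalk b x z k} → At w x 0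
    at-later : ∀ {b x y z k u j} {a : Adj x y} {e : EdgeKind b x y}
                 {w : AltWalk (not b) y z k} →
               At w u j → At (step a e w) u (suc j)

  OnPath : ∀ {f v k} → AltPath f v k → V → ℕ → Set
  OnPath p u j = At (AltPath.walk p) u j

  EvenLevel : V → ℕ∞ → Set
  EvenLevel v (fin l) =
    Even l × (∃ λ f → AltPath f v l) × (∀ f j → AltPath f v j → Even j → l ≤ j)
  EvenLevel v ∞ = ∀ f j → AltPath f v j → Even j → ⊥

  OddLevel : V → ℕ∞ → Set
  OddLevel v (fin l) =
    Odd l × (∃ λ f → AltPath f v l) × (∀ f j → AltPath f v j → Odd j → l ≤ j)
  OddLevel v ∞ = ∀ f j → AltPath f v j → Odd j → ⊥

  Tenacity : V → ℕ∞ → Set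
  Tenacity v t = Σ ℕ∞ λ e → Σ ℕ∞ λ o → EvenLevel v e × OddLevel v o × t ≡ e +∞ o

  BFSHonest : V → ℕ → Set
  BFSHonest u j = (Even j → EvenLevel u (fin j)) × (Odd j → OddLevel u (fin j))

-- Let a < j be the level of u of the parity of j. Follow a shortest such path until it
-- first meets the part r of p after u. Continuing along r to v cannot keep the walk
-- alternating, since p is a shortest path to v of its parity and the result would be
-- shorter; so continuing backwards along r to u does, which bounds the level b of u of
-- the other parity by a + |r|. A shortest path to v of the other parity, of length k′,
-- also ends on r; the same argument gives k′ ≥ j or b ≤ k′ + |r|, and either way
-- a + b < |p| + k′ = t(v).
module Submission where

open import Defs
open import Data.Nat using (ℕ; zero; suc; _+_; _≤_; _<_)
open import Data.Nat.Properties
open import Data.Fin using (Fin)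
import Data.Fin.Properties as Fin
open import Data.Bool using (Bool; true; false; not)
open import Data.Bool.Properties using (not-involutive; ¬-not)
import Data.Bool.Properties as Bool
open import Data.Sum as Sum using (_⊎_; inj₁; inj₂)
open import Data.Product using (Σ; ∃; ∃₂; _×_; _,_; proj₁; proj₂)
open import Data.Empty using (⊥; ⊥-elim)
open import Data.Unit using (tt)
open import Data.List using (List; []; _∷_; _++_; _∷ʳ_; reverse)
open import Data.List.Properties using (unfold-reverse)
import Data.List.Relation.Unary.All as All
import Data.List.Relation.Unary.All.Properties as All
open import Data.List.Relation.Unary.Any using (here; there)
open import Data.List.Relation.Unary.AllPairs using ([]; _∷_)
open import Data.List.Relation.Unary.Unique.Propositional using (Unique)
open import Data.List.Relation.Unary.Unique.Propositional.Properties using (++⁺)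
open import Data.List.Relation.Binary.Disjoint.Propositional using (Disjoint)
open import Data.List.Relation.Binary.Permutation.Propositional using (↭-sym; ↭⇒↭ₛ)
open import Data.List.Relation.Binary.Permutation.Propositional.Properties using (↭-reverse; ∈-resp-↭)
import Data.List.Relation.Binary.Permutation.Setoid.Properties as Permutationₛ
open import Data.List.Membership.Propositional using (_∈_)
open import Data.List.Membership.Propositional.Properties using (∈-++⁺ˡ; ∈-++⁺ʳ)
import Data.List.Membership.DecPropositional as DecMembership
open import Relation.Nullary using (¬_; yes; no; contradiction)
open import Relation.Binary.PropositionalEquality
open import Function using (id)

-- The kind (true = matched) of the edge following n steps of an alternating walk whose
-- first edge has kind b; hence parity n is true exactly when n is odd.
alternate : Bool → ℕ → Bool
alternate b zero    = b
alternate b (suc n) = alternate (not b) n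

parity : ℕ → Bool
parity = alternate false

alternate-not : ∀ b n → alternate (not b) n ≡ not (alternate b n)
alternate-not b zero    = refl
alternate-not b (suc n) = alternate-not (not b) n

alternate-+ : ∀ b m n → alternate b (m + n) ≡ alternate (alternate b m) n
alternate-+ b zero    n = refl
alternate-+ b (suc m) n = alternate-+ (not b) m n

alternate-involutive : ∀ b n → alternate (alternate b n) n ≡ b
alternate-involutive b zero    = refl
alternate-involutive b (suc n) = begin
  alternate (not (alternate (not b) n)) n ≡⟨ cong (λ c → alternate (not c) n) (alternate-not b n) ⟩
  alternate (not (not (alternate b n))) n ≡⟨ cong (λ c → alternate c n) (not-involutive _) ⟩
  alternate (alternate b n) n             ≡⟨ alternate-involutive b n ⟩
  b                                       ∎
  where open ≡-Reasoning

parity-resume : ∀ c m i r → parity m ≡ alternate c i → parity (m + r) ≡ alternate c (i + r)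
parity-resume c m i r eq = begin
  parity (m + r)             ≡⟨ alternate-+ false m r ⟩
  alternate (parity m) r     ≡⟨ cong (λ d → alternate d r) eq ⟩
  alternate (alternate c i) r ≡⟨ alternate-+ c i r ⟨
  alternate c (i + r)        ∎
  where open ≡-Reasoning

parity-return : ∀ c m i → parity m ≡ not (alternate c i) → parity (m + i) ≡ not c
parity-return c m i eq = begin
  parity (m + i)                    ≡⟨ alternate-+ false m i ⟩
  alternate (parity m) i            ≡⟨ cong (λ d → alternate d i) eq ⟩
  alternate (not (alternate c i)) i ≡⟨ alternate-not (alternate c i) i ⟩
  not (alternate (alternate c i) i) ≡⟨ cong not (alternate-involutive c i) ⟩
  not c                             ∎
  where open ≡-Reasoning

HasParity : Bool → ℕ → Set
HasParity false = Even
HasParity true  = Odd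

HasParity⇒parity≡ : ∀ b n → HasParity b n → parity n ≡ b
HasParity⇒parity≡ false zero          _  = refl
HasParity⇒parity≡ true  zero          ()
HasParity⇒parity≡ false (suc zero)    ()
HasParity⇒parity≡ true  (suc zero)    _  = refl
HasParity⇒parity≡ false (suc (suc n)) h  = HasParity⇒parity≡ false n h
HasParity⇒parity≡ true  (suc (suc n)) h  = HasParity⇒parity≡ true n h

HasParity-parity : ∀ n → HasParity (parity n) n
HasParity-parity zero          = refl
HasParity-parity (suc zero)    = refl
HasParity-parity (suc (suc n)) with parity n | HasParity-parity n
... | false | h = h
... | true  | h = h

parity≡⇒HasParity : ∀ {b} n → parity n ≡ b → HasParity b n
parity≡⇒HasParity n refl = HasParity-parity n

+∞-comm : ∀ x y → x +∞ y ≡ y +∞ x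
+∞-comm (fin a) (fin b) = cong fin (+-comm a b)
+∞-comm (fin a) ∞       = refl
+∞-comm ∞       (fin b) = refl
+∞-comm ∞       ∞       = refl

tenacity-arith : ∀ {a b j n k′} → a < j → b ≤ a + n → j ≤ k′ ⊎ b ≤ k′ + n → a + b < j + n + k′
tenacity-arith {a} {b} {j} {n} {k′} a<j b≤a+n bound =
  subst (a + b <_) (trans (cong (j +_) (+-comm k′ n)) (sym (+-assoc j n k′))) (+-mono-<-≤ a<j b≤k′+n)
  where
  b≤k′+n : b ≤ k′ + n
  b≤k′+n = Sum.[ (λ j≤k′ → ≤-trans b≤a+n (+-monoˡ-≤ n (≤-trans (<⇒≤ a<j) j≤k′))) , id ] bound

Unique-++⁻ : ∀ {A : Set} (xs : List A) {ys} → Unique (xs ++ ys) → Unique xs × Unique ys × Disjoint xs ys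
Unique-++⁻ []       u          = [] , u , λ ()
Unique-++⁻ (x ∷ xs) (x∉ ∷ u) with Unique-++⁻ xs u
... | u-xs , u-ys , disjoint =
  All.++⁻ˡ xs x∉ ∷ u-xs , u-ys ,
  λ { (here refl , y∈ys) → All.lookup (All.++⁻ʳ xs x∉) y∈ys refl
    ; (there y∈xs , y∈ys) → disjoint (y∈xs , y∈ys) }

Unique-reverse : ∀ {A : Set} {xs : List A} → Unique xs → Unique (reverse xs)
Unique-reverse {xs = xs} = Permutationₛ.Unique-resp-↭ (setoid _) (↭⇒↭ₛ (↭-sym (↭-reverse xs)))

module AlternatingPaths (G : Graph) (M : Fin (Graph.n G) → Fin (Graph.n G) → Set) (matching : IsMatching G M) where

  open Graph G using (Adj)
  open DecMembership (Fin._≟_ {Graph.n G}) using (_∈?_)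

  private
    Vertex : Set
    Vertex = Fin (Graph.n G)

    Walk : Bool → Vertex → Vertex → ℕ → Set
    Walk = AltWalk G M

    Path : Vertex → Vertex → ℕ → Set
    Path = AltPath G M

    vertices : ∀ {b x z n} → Walk b x z n → List Vertex
    vertices = verts G M

  tail : ∀ {b x z n} → Walk b x z n → List Vertex
  tail here         = []
  tail (step _ _ w) = vertices w

  vertices-tail : ∀ {b x z n} (w : Walk b x z n) → vertices w ≡ x ∷ tail w
  vertices-tail here         = refl
  vertices-tail (step _ _ w) = refl

  start∈vertices : ∀ {b x z n} (w : Walk b x z n) → x ∈ vertices w
  start∈vertices here         = here refl
  start∈vertices (step _ _ w) = here refl

  end∈vertices : ∀ {b x z n} (w : Walk b x z n) → z ∈ vertices w
  end∈vertices here         = here refl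
  end∈vertices (step _ _ w) = there (end∈vertices w)

  _++ʷ_ : ∀ {b x y z m n} → Walk b x y m → Walk (alternate b m) y z n → Walk b x z (m + n)
  here         ++ʷ t = t
  step a e w   ++ʷ t = step a e (w ++ʷ t)

  vertices-++ʷ : ∀ {b x y z m n} (w : Walk b x y m) (t : Walk (alternate b m) y z n) →
                 vertices (w ++ʷ t) ≡ vertices w ++ tail t
  vertices-++ʷ here         t = vertices-tail t
  vertices-++ʷ (step a e w) t = cong (_ ∷_) (vertices-++ʷ w t)

  snoc : ∀ {b x y z n} → Walk b x y n → Adj y z → EdgeKind G M (alternate b n) y z → Walk b x z (suc n)
  snoc here          a e = step a e here
  snoc (step a′ e′ w) a e = step a′ e′ (snoc w a e)

  vertices-snoc : ∀ {b x y z n} (w : Walk b x y n) (a : Adj y z) (e : EdgeKind G M (alternate b n) y z) →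
                  vertices (snoc w a e) ≡ vertices w ∷ʳ z
  vertices-snoc here          a e = refl
  vertices-snoc (step a′ e′ w) a e = cong (_ ∷_) (vertices-snoc w a e)

  EdgeKind-sym : ∀ b {x y} → EdgeKind G M b x y → EdgeKind G M b y x
  EdgeKind-sym true  e = IsMatching.msym matching e
  EdgeKind-sym false e = λ m → e (IsMatching.msym matching m)

  reverseʷ : ∀ {b x z n} → Walk b x z n → Walk (not (alternate b n)) z x n
  reverseʷ here = here
  reverseʷ {b} {x} (step {y = y} {k = n} a e w) =
    snoc (reverseʷ w) (Graph.sym G a)
         (subst (λ c → EdgeKind G M c y x) (sym (alternate-involutive b (suc n))) (EdgeKind-sym b e))

  vertices-reverseʷ : ∀ {b x z n} (w : Walk b x z n) → vertices (reverseʷ w) ≡ reverse (vertices w)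
  vertices-reverseʷ here = refl
  vertices-reverseʷ {x = x} w@(step a e w′) = begin
    vertices (reverseʷ w)          ≡⟨ vertices-snoc (reverseʷ w′) _ _ ⟩
    vertices (reverseʷ w′) ∷ʳ x    ≡⟨ cong (_∷ʳ x) (vertices-reverseʷ w′) ⟩
    reverse (vertices w′) ∷ʳ x     ≡⟨ unfold-reverse x (vertices w′) ⟨
    reverse (x ∷ vertices w′)      ∎
    where open ≡-Reasoning

  ∈-reverseʷ : ∀ {b x z n y} (w : Walk b x z n) → y ∈ vertices (reverseʷ w) → y ∈ vertices w
  ∈-reverseʷ w y∈ = ∈-resp-↭ (↭-reverse (vertices w)) (subst (_ ∈_) (vertices-reverseʷ w) y∈)

  Unique-reverseʷ : ∀ {b x z n} (w : Walk b x z n) → Unique (vertices w) → Unique (vertices (reverseʷ w))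
  Unique-reverseʷ w u = subst Unique (sym (vertices-reverseʷ w)) (Unique-reverse u)

  record Split {b x z n} (w : Walk b x z n) (y : Vertex) (i : ℕ) : Set where
    field
      rest         : ℕ
      prefix       : Walk b x y i
      suffix       : Walk (alternate b i) y z rest
      length-split : n ≡ i + rest
      vertices-split : vertices w ≡ vertices prefix ++ tail suffix

  open Split

  split-start : ∀ {b x z n} (w : Walk b x z n) → Split w x 0
  split-start w = record { prefix = here ; suffix = w ; length-split = refl ; vertices-split = vertices-tail w }

  split-step : ∀ {b x y z n y′ i} {a : Adj x y} {e : EdgeKind G M b x y} {w : Walk (not b) y z n} →
               Split w y′ i → Split (step a e w) y′ (suc i)
  split-step {x = x} {a = a} {e} sp = record
    { prefix = step a e (prefix sp) ; suffix = suffix sp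
    ; length-split = cong suc (length-split sp) ; vertices-split = cong (x ∷_) (vertices-split sp) }

  split-at : ∀ {b x z n y i} {w : Walk b x z n} → At G M w y i → Split w y i
  split-at {w = w} at-start = split-start w
  split-at (at-later at)    = split-step (split-at at)

  ∈⇒At : ∀ {b x z n y} (w : Walk b x z n) → y ∈ vertices w → ∃ (At G M w y)
  ∈⇒At here         (here refl) = 0 , at-start
  ∈⇒At (step a e w) (here refl) = 0 , at-start
  ∈⇒At (step a e w) (there y∈)  with ∈⇒At w y∈
  ... | i , at = suc i , at-later at

  ∈-prefix : ∀ {b x z n y i v} {w : Walk b x z n} (sp : Split w y i) → v ∈ vertices (prefix sp) → v ∈ vertices w
  ∈-prefix sp v∈ = subst (_ ∈_) (sym (vertices-split sp)) (∈-++⁺ˡ v∈)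

  ∈-suffix : ∀ {b x z n y i v} {w : Walk b x z n} (sp : Split w y i) → v ∈ vertices (suffix sp) → v ∈ vertices w
  ∈-suffix sp v∈ with subst (_ ∈_) (vertices-tail (suffix sp)) v∈
  ... | here refl = ∈-prefix sp (end∈vertices (prefix sp))
  ... | there v∈tail = subst (_ ∈_) (sym (vertices-split sp)) (∈-++⁺ʳ _ v∈tail)

  Unique-split : ∀ {b x z n y i} {w : Walk b x z n} (sp : Split w y i) → Unique (vertices w) →
                 Unique (vertices (prefix sp)) × Unique (vertices (suffix sp))
  Unique-split sp u with Unique-++⁻ (vertices (prefix sp)) (subst Unique (vertices-split sp) u)
  ... | u-prefix , u-tail , disjoint = u-prefix ,
    subst Unique (sym (vertices-tail (suffix sp)))
          (All.tabulate (λ y∈tail y≡ → disjoint (end∈vertices (prefix sp) , subst (_∈ _) (sym y≡) y∈tail)) ∷ u-tail)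

  split-≤ : ∀ {b x z n y i} {w : Walk b x z n} → Split w y i → i ≤ n
  split-≤ {i = i} sp = subst (i ≤_) (sym (length-split sp)) (m≤m+n i (rest sp))

  prefix-path : ∀ {f v k y i} (p : Path f v k) (sp : Split (AltPath.walk p) y i) → Path f y i
  prefix-path p sp = altPath (AltPath.unmatchedStart p) (prefix sp)
                             (proj₁ (Unique-split sp (AltPath.simple p)))

  first-in : ∀ (S : List Vertex) {b x z n} (w : Walk b x z n) → z ∈ S →
             ∃₂ λ y i → y ∈ S × Σ (Split w y i) λ sp → ∀ {v} → v ∈ vertices (prefix sp) → v ∈ S → v ≡ y
  first-in S w@here z∈S = _ , 0 , z∈S , split-start w , λ { (here eq) _ → eq }
  first-in S {x = x} w@(step a e w′) z∈S with x ∈? S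
  ... | yes x∈S = x , 0 , x∈S , split-start w , λ { (here eq) _ → eq }
  ... | no x∉S with first-in S w′ z∈S
  ...   | y , i , y∈S , sp , first = y , suc i , y∈S , split-step sp ,
          λ { (here refl) v∈S → contradiction v∈S x∉S ; (there v∈) v∈S → first v∈ v∈S }

  glue : ∀ {g w z m l d} (s : Path g w m) → d ≡ parity m → (t : Walk d w z l) → Unique (vertices t) →
         (∀ {v} → v ∈ vertices (AltPath.walk s) → v ∈ vertices t → v ≡ w) → Path g z (m + l)
  glue s refl t t-simple meet with subst Unique (vertices-tail t) t-simple
  ... | w∉tail ∷ u-tail = altPath (AltPath.unmatchedStart s) (AltPath.walk s ++ʷ t)
    (subst Unique (sym (vertices-++ʷ (AltPath.walk s) t)) (++⁺ (AltPath.simple s) u-tail disjoint))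
    where
    disjoint : Disjoint (vertices (AltPath.walk s)) (tail t)
    disjoint (v∈s , v∈tail) with meet v∈s (subst (_ ∈_) (sym (vertices-tail t)) (there v∈tail))
    ... | refl = All.lookup w∉tail v∈tail refl

  record PathWithin (g x : Vertex) (b : Bool) (bound : ℕ) : Set where
    constructor pathWithin
    field
      len        : ℕ
      path       : Path g x len
      len-parity : parity len ≡ b
      len≤bound  : len ≤ bound

  PathWithin-weaken : ∀ {g x b m n} → m ≤ n → PathWithin g x b m → PathWithin g x b n
  PathWithin-weaken m≤n (pathWithin len path len-parity len≤m) =
    pathWithin len path len-parity (≤-trans len≤m m≤n)

  -- The edges of t on either side of w have opposite kinds, so s continues alternatingly
  -- along t either forward to v or backward to u.
  rejoin : ∀ {c u v n g w m i} (t : Walk c u v n) → Unique (vertices t) →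
           (s : Path g w m) → (cut : Split t w i) →
           (∀ {x} → x ∈ vertices (AltPath.walk s) → x ∈ vertices t → x ≡ w) →
           PathWithin g v (alternate c n) (m + n) ⊎ PathWithin g u (not c) (m + n)
  rejoin {c} {m = m} {i} t t-simple s cut@record { rest = r ; length-split = refl } meet
    with Unique-split cut t-simple | parity m Bool.≟ alternate c i
  ... | _ , suffix-simple | yes eq = inj₁ (pathWithin _
          (glue s (sym eq) (suffix cut) suffix-simple (λ x∈s x∈suffix → meet x∈s (∈-suffix cut x∈suffix)))
          (parity-resume c m i r eq) (+-monoʳ-≤ m (m≤n+m r i)))
  ... | prefix-simple , _ | no neq = inj₂ (pathWithin _
          (glue s (sym (¬-not neq)) (reverseʷ (prefix cut)) (Unique-reverseʷ (prefix cut) prefix-simple)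
                (λ x∈s x∈prefix → meet x∈s (∈-prefix cut (∈-reverseʷ (prefix cut) x∈prefix))))
          (parity-return c m i (¬-not neq)) (+-monoʳ-≤ m (m≤m+n i r)))

  shortcut : ∀ {c u v n g z l} (t : Walk c u v n) → Unique (vertices t) → Path g z l → z ∈ vertices t →
             PathWithin g v (alternate c n) (l + n) ⊎ PathWithin g u (not c) (l + n)
  shortcut t t-simple s z∈t with first-in (vertices t) (AltPath.walk s) z∈t
  ... | w , m , w∈t , hit , first with ∈⇒At t w∈t
  ...   | i , w-at-i = Sum.map (PathWithin-weaken m+n≤l+n) (PathWithin-weaken m+n≤l+n)
                              (rejoin t t-simple (prefix-path s hit) (split-at w-at-i) first)
    where
    m+n≤l+n = +-monoˡ-≤ _ (split-≤ hit)

  Level : Bool → Vertex → ℕ∞ → Set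
  Level false = EvenLevel G M
  Level true  = OddLevel G M

  level-fin : ∀ b {v l} → Level b v (fin l) →
              parity l ≡ b × (∃ λ f → Path f v l) × (∀ {f j} → Path f v j → parity j ≡ b → l ≤ j)
  level-fin false {l = l} (h , q , min) =
    HasParity⇒parity≡ false l h , q , λ {_} {j} q′ eq → min _ j q′ (parity≡⇒HasParity j eq)
  level-fin true  {l = l} (h , q , min) =
    HasParity⇒parity≡ true l h , q , λ {_} {j} q′ eq → min _ j q′ (parity≡⇒HasParity j eq)

  level-∞ : ∀ b {v f j} → Level b v ∞ → Path f v j → parity j ≡ b → ⊥
  level-∞ false {j = j} none q eq = none _ j q (parity≡⇒HasParity j eq)
  level-∞ true  {j = j} none q eq = none _ j q (parity≡⇒HasParity j eq)

  level-≤ : ∀ b {v x f l} → Level b v x → Path f v l → parity l ≡ b → ∃ λ a → x ≡ fin a × a ≤ l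
  level-≤ b {x = fin a} L q eq = a , refl , proj₂ (proj₂ (level-fin b L)) q eq
  level-≤ b {x = ∞}     L q eq = ⊥-elim (level-∞ b L q eq)

  level-unique : ∀ b {v a x} → Level b v (fin a) → Level b v x → x ≡ fin a
  level-unique b La Lx with level-fin b La
  ... | a-parity , (_ , q) , a-min with level-≤ b Lx q a-parity
  ...   | a′ , refl , a′≤a with level-fin b Lx
  ...     | a′-parity , (_ , q′) , _ = cong fin (≤-antisym a′≤a (a-min q′ a′-parity))

  level-own-parity : ∀ {v k} → EvenLevel G M v (fin k) ⊎ OddLevel G M v (fin k) → Level (parity k) v (fin k)
  level-own-parity {v} {k} (inj₁ L) = subst (λ b → Level b v (fin k)) (sym (HasParity⇒parity≡ false k (proj₁ L))) L
  level-own-parity {v} {k} (inj₂ L) = subst (λ b → Level b v (fin k)) (sym (HasParity⇒parity≡ true  k (proj₁ L))) L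

  tenacity-split : ∀ b {u t} → Tenacity G M u t → ∃₂ λ x y → Level b u x × Level (not b) u y × t ≡ x +∞ y
  tenacity-split false (e , o , E , O , t≡) = e , o , E , O , t≡
  tenacity-split true  (e , o , E , O , t≡) = o , e , O , E , trans t≡ (+∞-comm e o)

  honest : ∀ {u} j → Level (parity j) u (fin j) → BFSHonest G M u j
  honest {u} j L = (λ e → subst (λ b → Level b u (fin j)) (HasParity⇒parity≡ false j e) L)
                 , (λ o → subst (λ b → Level b u (fin j)) (HasParity⇒parity≡ true j o) L)

  dishonest-level : ∀ {f u j x} → Path f u j → ¬ BFSHonest G M u j → Level (parity j) u x →
                    ∃ λ a → x ≡ fin a × a < j
  dishonest-level {j = j} q dishonest L with level-≤ (parity j) L q refl
  ... | a , refl , a≤j = a , refl , ≤∧≢⇒< a≤j λ { refl → dishonest (honest j L) }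

  module _ {u v j n} (rest : Walk (parity j) u v n) (rest-simple : Unique (vertices rest))
           (shortest : ∀ {g l} → Path g v l → parity l ≡ parity (j + n) → j + n ≤ l) where

    detour : ∀ {g z l} → Path g z l → z ∈ vertices rest → j ≤ l ⊎ PathWithin g u (not (parity j)) (l + n)
    detour s z∈rest with shortcut rest rest-simple s z∈rest
    ... | inj₁ (pathWithin _ q q-parity q≤) =
          inj₁ (+-cancelʳ-≤ n j _ (≤-trans (shortest q (trans q-parity (sym (alternate-+ false j n)))) q≤))
    ... | inj₂ back = inj₂ back

    opposite-level-of-u : ∀ {a y} → Level (parity j) u (fin a) → a < j → Level (not (parity j)) u y →
                          ∃ λ b → y ≡ fin b × b ≤ a + n
    opposite-level-of-u La a<j Ly with proj₁ (proj₂ (level-fin (parity j) La))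
    ... | _ , q with detour q (start∈vertices rest)
    ...   | inj₁ j≤a = contradiction a<j (≤⇒≯ j≤a)
    ...   | inj₂ (pathWithin _ q′ q′-parity q′≤) with level-≤ _ Ly q′ q′-parity
    ...     | b , refl , b≤ = b , refl , ≤-trans b≤ q′≤

    opposite-level-of-v : ∀ {k′ b} → Level (not (parity (j + n))) v (fin k′) →
                          Level (not (parity j)) u (fin b) → j ≤ k′ ⊎ b ≤ k′ + n
    opposite-level-of-v Lk′ Lb with proj₁ (proj₂ (level-fin (not (parity (j + n))) Lk′))
    ... | _ , q with detour q (end∈vertices rest)
    ...   | inj₁ j≤k′ = inj₁ j≤k′
    ...   | inj₂ (pathWithin _ q′ q′-parity q′≤) with level-≤ _ Lb q′ q′-parity
    ...     | _ , refl , b≤ = inj₂ (≤-trans b≤ q′≤)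

    tenacity-< : ∀ {a y y′} → Level (parity j) u (fin a) → a < j → Level (not (parity j)) u y →
                 Level (not (parity (j + n))) v y′ → (fin a +∞ y) <∞ (fin (j + n) +∞ y′)
    tenacity-< La a<j Ly Ly′ with opposite-level-of-u La a<j Ly
    tenacity-< {y′ = ∞}      La a<j Ly Ly′ | b , refl , b≤ = tt
    tenacity-< {y′ = fin k′} La a<j Ly Ly′ | b , refl , b≤ = tenacity-arith a<j b≤ (opposite-level-of-v Ly′ Ly)

  tenacity-dishonest-< : ∀ {f v k} (p : Path f v k) → EvenLevel G M v (fin k) ⊎ OddLevel G M v (fin k) →
                         ∀ {u j} → OnPath G M p u j → ¬ BFSHonest G M u j →
                         ∀ {tu tv} → Tenacity G M u tu → Tenacity G M v tv → tu <∞ tv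
  tenacity-dishonest-< {k = k} p level-v {j = j} u∈p dishonest ten-u ten-v
    with split-at u∈p | level-own-parity level-v
  ... | cut@record { length-split = refl } | Lv
    with tenacity-split (parity j) ten-u | tenacity-split (parity k) ten-v
  ... | x , y , Lx , Ly , refl | x′ , y′ , Lx′ , Ly′ , refl
    with dishonest-level (prefix-path p cut) dishonest Lx | level-unique (parity (j + rest cut)) Lv Lx′
  ... | a , refl , a<j | refl =
    tenacity-< (suffix cut) (proj₂ (Unique-split cut (AltPath.simple p))) (proj₂ (proj₂ (level-fin _ Lv)))
               Lx a<j Ly Ly′

corollary5p3 : (G : Graph) (M : Fin (Graph.n G) → Fin (Graph.n G) → Set) → IsMatching G M →
    ∀ (f v : Fin (Graph.n G)) (k : ℕ) (p : AltPath G M f v k) →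
    (EvenLevel G M v (fin k) ⊎ OddLevel G M v (fin k)) →
    ∀ (u : Fin (Graph.n G)) (j : ℕ) → OnPath G M p u j →
    ¬ BFSHonest G M u j →
    ∀ (tu tv : ℕ∞) → Tenacity G M u tu → Tenacity G M v tv → tu <∞ tv
corollary5p3 G M matching f v k p level-v u j u∈p dishonest tu tv =
  AlternatingPaths.tenacity-dishonest-< G M matching p level-v u∈p dishonest
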